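{- Let $C',I'$ be two disjoint subsets of the vertex set $V$ of a graph $G$, and let $x\notin C'\cup I'$ be a vertex of degree $1$ in $G$. Then $G$ is $(C',I')$-monopolar extendable if and only if $G-\{x\}$ is $(C',I')$-monopolar extendable.
   Context: All graphs are finite, simple and undirected. A graph is a cluster graph if each connected component is complete. A partition $V=C\uplus I$ of the vertex set of $G$ is a monopolar partition if $G[C]$ is a cluster graph and $I$ is independent in $G$. For disjoint $C',I'\subseteq V$, $G$ is $(C',I')$-monopolar extendable if it has a monopolar partition $V=C\uplus I$ with $C'\subseteq C$ and $I'\subseteq I$. -}

module Defs where

open import Data.Nat using (ℕ; suc)
open import Data.Fin using (Fin; punchIn)
open import Data.Fin.Subset using (Subset; _∈_; _∉_; _⊆_)
open import Data.Vec using (tabulate; lookup)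
open import Data.Product using (Σ; _×_; _,_; ∃)
open import Data.Sum using (_⊎_)
open import Relation.Nullary using (¬_)
open import Relation.Binary.PropositionalEquality using (_≡_)

record Graph (n : ℕ) : Set₁ where
  field
    Adj   : Fin n → Fin n → Set
    sym   : ∀ {u v} → Adj u v → Adj v u
    irrefl : ∀ {u} → ¬ Adj u u
open Graph public

-- Reach G S u v : v is reachable from u by a path inside the induced
-- subgraph G[S] (u, v ∈ S); these are the connected components of G[S].
data Reach {n : ℕ} (G : Graph n) (S : Subset n) : Fin n → Fin n → Set where
  here : ∀ {u} → u ∈ S → Reach G S u u
  step : ∀ {u w v} → u ∈ S → Adj G u w → Reach G S w v → Reach G S u v

IsClusterInduced : {n : ℕ} → Graph n → Subset n → Set
IsClusterInduced G S = ∀ u v → Reach G S u v → ¬ (u ≡ v) → Adj G u v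

Independent : {n : ℕ} → Graph n → Subset n → Set
Independent G I = ∀ u v → u ∈ I → v ∈ I → ¬ Adj G u v

MonopolarPartition : {n : ℕ} → Graph n → Subset n → Subset n → Set
MonopolarPartition G C I =
  (∀ v → v ∈ C ⊎ v ∈ I) × (∀ v → v ∈ C → v ∉ I) ×
  IsClusterInduced G C × Independent G I

MonopolarExtendable : {n : ℕ} → Graph n → Subset n → Subset n → Set
MonopolarExtendable {n} G C' I' =
  Σ (Subset n) λ C → Σ (Subset n) λ I →
    MonopolarPartition G C I × C' ⊆ C × I' ⊆ I

DegreeOne : {n : ℕ} → Graph n → Fin n → Set
DegreeOne G x = Σ _ λ y → Adj G x y × (∀ z → Adj G x z → z ≡ y)

-- G - {x}: vertices Fin m embedded into Fin (suc m) skipping x.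
deleteVertex : {m : ℕ} → Graph (suc m) → Fin (suc m) → Graph m
deleteVertex G x = record
  { Adj = λ u v → Adj G (punchIn x u) (punchIn x v)
  ; sym = sym G
  ; irrefl = irrefl G }

restrict : {m : ℕ} → Fin (suc m) → Subset (suc m) → Subset m
restrict x S = tabulate λ i → lookup S (punchIn x i)

-- Deleting a vertex restricts every monopolar partition, so only the converse needs an
-- argument. Given a monopolar partition of G - x, put the pendant vertex x on the side
-- opposite to its unique neighbour y: in I it is not adjacent to anything else in I, and
-- in C it forms a singleton component, because y then lies in I.
module Submission where

open import Defs
open import Data.Nat using (ℕ; suc)
open import Data.Bool using (true; false; not)
open import Data.Empty using (⊥-elim)
open import Data.Fin using (Fin; punchIn; punchOut)
open import Data.Fin.Properties using (_≟_; punchIn-injective; punchIn-punchOut)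
open import Data.Fin.Subset using (Subset; _∈_; _∉_; _⊆_; Empty; _∩_)
open import Data.Product using (Σ; _×_; _,_)
open import Data.Sum using (_⊎_; inj₁; inj₂; [_,_])
import Data.Sum as Sum
open import Data.Vec using (lookup; insertAt)
open import Data.Vec.Properties
  using ([]=⇒lookup; lookup⇒[]=; lookup∘tabulate; tabulate∘lookup; tabulate-cong; insertAt-lookup; insertAt-punchIn)
open import Function.Bundles using (_⇔_; mk⇔)
open import Relation.Nullary using (¬_; yes; no)
open import Relation.Binary.PropositionalEquality
  using (_≡_; refl; trans; cong; subst; subst₂) renaming (sym to ≡-sym)

Reach-source∈ : ∀ {n} {G : Graph n} {S u v} → Reach G S u v → u ∈ S
Reach-source∈ (here u∈S)     = u∈S
Reach-source∈ (step u∈S _ _) = u∈S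

IsolatedIn : ∀ {n} → Graph n → Subset n → Fin n → Set
IsolatedIn G S x = x ∈ S → ∀ v → v ∈ S → ¬ Adj G x v

module _ {m : ℕ} (x : Fin (suc m)) where

  data PunchInView : Fin (suc m) → Set where
    at-x    : PunchInView x
    punched : ∀ a → PunchInView (punchIn x a)

  punchInView : ∀ v → PunchInView v
  punchInView v with x ≟ v
  ... | yes refl = at-x
  ... | no x≢v   = subst PunchInView (punchIn-punchOut x≢v) (punched (punchOut x≢v))

  ∈-restrict⁺ : ∀ {S a} → punchIn x a ∈ S → a ∈ restrict x S
  ∈-restrict⁺ {S} {a} p =
    lookup⇒[]= a _ (trans (lookup∘tabulate (λ i → lookup S (punchIn x i)) a) ([]=⇒lookup p))

  ∈-restrict⁻ : ∀ {S a} → a ∈ restrict x S → punchIn x a ∈ S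
  ∈-restrict⁻ {S} {a} p =
    lookup⇒[]= _ S (trans (≡-sym (lookup∘tabulate (λ i → lookup S (punchIn x i)) a)) ([]=⇒lookup p))

  restrict-⊆ : ∀ {S T} → S ⊆ T → restrict x S ⊆ restrict x T
  restrict-⊆ S⊆T a∈S = ∈-restrict⁺ (S⊆T (∈-restrict⁻ a∈S))

  restrict-insertAt : ∀ (S : Subset m) b → restrict x (insertAt S x b) ≡ S
  restrict-insertAt S b = trans (tabulate-cong (insertAt-punchIn S x b)) (tabulate∘lookup S)

  ∈-insertAt⁻ : ∀ {S b a} → punchIn x a ∈ insertAt S x b → a ∈ S
  ∈-insertAt⁻ {S} {b} {a} p = subst (a ∈_) (restrict-insertAt S b) (∈-restrict⁺ p)

  x∈insertAt⇒ : ∀ {S b} → x ∈ insertAt S x b → b ≡ true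
  x∈insertAt⇒ {S} {b} p = trans (≡-sym (insertAt-lookup S x b)) ([]=⇒lookup p)

  x∈insertAt : ∀ S → x ∈ insertAt S x true
  x∈insertAt S = lookup⇒[]= x _ (insertAt-lookup S x true)

  ⊆-insertAt : ∀ {S T b} → x ∉ S → restrict x S ⊆ T → S ⊆ insertAt T x b
  ⊆-insertAt {S} {T} {b} x∉S S⊆T {v} v∈S with punchInView v
  ... | at-x      = ⊥-elim (x∉S v∈S)
  ... | punched a =
    ∈-restrict⁻ (subst (a ∈_) (≡-sym (restrict-insertAt T b)) (S⊆T (∈-restrict⁺ v∈S)))

module _ {m : ℕ} (G : Graph (suc m)) (x : Fin (suc m)) where

  private
    G-x = deleteVertex G x

  Reach-restrict⁻ : ∀ {S a b} → Reach G-x (restrict x S) a b → Reach G S (punchIn x a) (punchIn x b)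
  Reach-restrict⁻ (here a∈S)       = here (∈-restrict⁻ x a∈S)
  Reach-restrict⁻ (step a∈S a~c r) = step (∈-restrict⁻ x a∈S) a~c (Reach-restrict⁻ r)

  Reach-restrict⁺ : ∀ {S v} → IsolatedIn G S x → ∀ a → Reach G S (punchIn x a) v →
    Σ (Fin m) λ b → punchIn x b ≡ v × Reach G-x (restrict x S) a b
  Reach-restrict⁺ iso a (here a∈S) = a , refl , here (∈-restrict⁺ x a∈S)
  Reach-restrict⁺ iso a (step {w = w} a∈S a~w r) with punchInView x w
  ... | at-x      = ⊥-elim (iso (Reach-source∈ r) _ a∈S (sym G a~w))
  ... | punched c with Reach-restrict⁺ iso c r
  ...   | b , b↑≡v , r′ = b , b↑≡v , step (∈-restrict⁺ x a∈S) a~w r′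

  IsClusterInduced-restrict : ∀ {S} → IsClusterInduced G S → IsClusterInduced G-x (restrict x S)
  IsClusterInduced-restrict cluster a b r a≢b =
    cluster _ _ (Reach-restrict⁻ r) (λ e → a≢b (punchIn-injective x a b e))

  IsClusterInduced-unrestrict : ∀ {S} → IsolatedIn G S x →
    IsClusterInduced G-x (restrict x S) → IsClusterInduced G S
  IsClusterInduced-unrestrict iso cluster u v r u≢v with punchInView x u | r
  ... | at-x      | here _          = ⊥-elim (u≢v refl)
  ... | at-x      | step x∈S x~w r′ = ⊥-elim (iso x∈S _ (Reach-source∈ r′) x~w)
  ... | punched a | _ with Reach-restrict⁺ iso a r
  ...   | b , refl , r′ = cluster a b r′ (λ a≡b → u≢v (cong (punchIn x) a≡b))

  Independent-restrict : ∀ {S} → Independent G S → Independent G-x (restrict x S)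
  Independent-restrict indep a b a∈S b∈S = indep _ _ (∈-restrict⁻ x a∈S) (∈-restrict⁻ x b∈S)

  Independent-unrestrict : ∀ {S} → IsolatedIn G S x →
    Independent G-x (restrict x S) → Independent G S
  Independent-unrestrict iso indep u v u∈S v∈S u~v with punchInView x u | punchInView x v
  ... | at-x      | _         = iso u∈S v v∈S u~v
  ... | punched a | at-x      = iso v∈S u u∈S (sym G u~v)
  ... | punched a | punched b = indep a b (∈-restrict⁺ x u∈S) (∈-restrict⁺ x v∈S) u~v

  MonopolarPartition-restrict : ∀ {C I} → MonopolarPartition G C I →
    MonopolarPartition G-x (restrict x C) (restrict x I)
  MonopolarPartition-restrict (cover , disjoint , cluster , indep) =
    (λ a → Sum.map (∈-restrict⁺ x) (∈-restrict⁺ x) (cover (punchIn x a))) ,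
    (λ a a∈C a∈I → disjoint _ (∈-restrict⁻ x a∈C) (∈-restrict⁻ x a∈I)) ,
    IsClusterInduced-restrict cluster ,
    Independent-restrict indep

  MonopolarExtendable-restrict : ∀ {C′ I′} → MonopolarExtendable G C′ I′ →
    MonopolarExtendable G-x (restrict x C′) (restrict x I′)
  MonopolarExtendable-restrict (C , I , partition , C′⊆C , I′⊆I) =
    restrict x C , restrict x I , MonopolarPartition-restrict partition ,
    restrict-⊆ x C′⊆C , restrict-⊆ x I′⊆I

  MonopolarPartition-unrestrict : ∀ {C I} →
    MonopolarPartition G-x (restrict x C) (restrict x I) →
    x ∈ C ⊎ x ∈ I → (x ∈ C → x ∉ I) → IsolatedIn G C x → IsolatedIn G I x →
    MonopolarPartition G C I
  MonopolarPartition-unrestrict (cover , disjoint , cluster , indep) x-covered x-disjoint isoC isoI =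
    cover′ , disjoint′ ,
    IsClusterInduced-unrestrict isoC cluster ,
    Independent-unrestrict isoI indep
    where
    cover′ : ∀ v → v ∈ _ ⊎ v ∈ _
    cover′ v with punchInView x v
    ... | at-x      = x-covered
    ... | punched a = Sum.map (∈-restrict⁻ x) (∈-restrict⁻ x) (cover a)

    disjoint′ : ∀ v → v ∈ _ → v ∉ _
    disjoint′ v with punchInView x v
    ... | at-x      = x-disjoint
    ... | punched a = λ a∈C a∈I → disjoint a (∈-restrict⁺ x a∈C) (∈-restrict⁺ x a∈I)

  MonopolarPartition-insertAt : ∀ {C I} → MonopolarPartition G-x C I → ∀ b →
    IsolatedIn G (insertAt C x b) x → IsolatedIn G (insertAt I x (not b)) x →
    MonopolarPartition G (insertAt C x b) (insertAt I x (not b))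
  MonopolarPartition-insertAt {C} {I} partition b =
    MonopolarPartition-unrestrict
      (subst₂ (MonopolarPartition G-x)
        (≡-sym (restrict-insertAt x C b)) (≡-sym (restrict-insertAt x I (not b))) partition)
      (x-covered b)
      (λ x∈C x∈I → not-true (x∈insertAt⇒ x x∈C) (x∈insertAt⇒ x x∈I))
    where
    x-covered : ∀ b → x ∈ insertAt C x b ⊎ x ∈ insertAt I x (not b)
    x-covered true  = inj₁ (x∈insertAt x C)
    x-covered false = inj₂ (x∈insertAt x I)

    not-true : ∀ {b} → b ≡ true → ¬ not b ≡ true
    not-true refl ()

  IsolatedIn-pendant : ∀ {S y} → (∀ z → Adj G x z → z ≡ y) → (x ∈ S → y ∉ S) → IsolatedIn G S x
  IsolatedIn-pendant only-y y∉S x∈S v v∈S x~v = y∉S x∈S (subst (_∈ _) (only-y v x~v) v∈S)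

  MonopolarExtendable-unrestrict : ∀ {C′ I′} → DegreeOne G x → x ∉ C′ → x ∉ I′ →
    MonopolarExtendable G-x (restrict x C′) (restrict x I′) → MonopolarExtendable G C′ I′
  MonopolarExtendable-unrestrict {C′} {I′} (y , x~y , only-y) x∉C′ x∉I′
    (C , I , partition@(cover , disjoint , _ , _) , C′⊆C , I′⊆I) with punchInView x y
  ... | at-x       = ⊥-elim (irrefl G x~y)
  ... | punched y′ =
    [ (λ y′∈C → opposite false (λ ()) (λ _ → disjoint y′ y′∈C))
    , (λ y′∈I → opposite true (λ _ y′∈C → disjoint y′ y′∈C y′∈I) (λ ()))
    ] (cover y′)
    where
    isolated : ∀ {T b} → (b ≡ true → y′ ∉ T) → IsolatedIn G (insertAt T x b) x
    isolated y′∉T = IsolatedIn-pendant only-y (λ x∈T y∈T → y′∉T (x∈insertAt⇒ x x∈T) (∈-insertAt⁻ x y∈T))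

    opposite : ∀ b → (b ≡ true → y′ ∉ C) → (not b ≡ true → y′ ∉ I) → MonopolarExtendable G C′ I′
    opposite b y′∉C y′∉I =
      insertAt C x b , insertAt I x (not b) ,
      MonopolarPartition-insertAt partition b (isolated y′∉C) (isolated y′∉I) ,
      ⊆-insertAt x x∉C′ C′⊆C , ⊆-insertAt x x∉I′ I′⊆I

lemma2 : {m : ℕ} (G : Graph (suc m)) (C' I' : Subset (suc m)) (x : Fin (suc m)) →
    Empty (C' ∩ I') → x ∉ C' → x ∉ I' → DegreeOne G x →
    MonopolarExtendable G C' I' ⇔
      MonopolarExtendable (deleteVertex G x) (restrict x C') (restrict x I')
lemma2 G C' I' x _ x∉C' x∉I' deg-x =
  mk⇔ (MonopolarExtendable-restrict G x) (MonopolarExtendable-unrestrict G x deg-x x∉C' x∉I')
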